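{- Let $T:\mathcal C\to\mathcal A$ be a covariant functor satisfying (Ax0), (Ax1), (Ax2), (Ax3), (Ax2*) and (Ax5). Then the full subcategory $\mathrm{Max}(\mathcal C)$ of $\mathcal C$ is an abelian category and the restriction of $T$ to $\mathrm{Max}(\mathcal C)$ is exact.
   Context: For $A\in\mathcal A$, the fibre $\mathcal F_A$ is the category whose objects are pairs $(C,f)$ with $C\in\mathcal C$ and $f:T(C)\to A$ an isomorphism, a morphism $(C,f)\to(C',f')$ being a morphism $g:C\to C'$ with $f=f'\circ T(g)$. Axioms: (Ax0) for every $C\in\mathcal C$ and every isomorphism $f:T(C)\to A'$ in $\mathcal A$ there is an isomorphism $g:C\to C'$ in $\mathcal C$ with $T(g)=f$; (Ax1) $T$ is faithful; (Ax2) $\mathcal C$ and $\mathcal A$ admit pushouts and $T$ preserves them; (Ax2*) $\mathcal C$ and $\mathcal A$ admit fibre products and $T$ preserves them; (Ax3) for every $A$, $\mathcal F_A$ is either empty or has a final object; (Ax5) $\mathcal C$ is additive, $\mathcal A$ is abelian and $T$ is additive. $\mathrm{Max}(\mathcal C)$ is the full subcategory of $\mathcal C$ whose objects are those $C$ for which $(C,\mathrm{id}_{T(C)})$ is a final object of $\mathcal F_{T(C)}$. -}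

module Defs where

open import Level using (Level; _⊔_) renaming (suc to lsuc)
open import Data.Product using (Σ; _×_; _,_; proj₁; proj₂)
open import Data.Sum using (_⊎_)
open import Relation.Nullary using (¬_)
open import Relation.Binary.PropositionalEquality using (_≡_; subst)

record Category (o ℓ : Level) : Set (lsuc (o ⊔ ℓ)) where
  infixr 9 _∘_
  infix 4 _⇒_
  field
    Obj : Set o
    _⇒_ : Obj → Obj → Set ℓ
    id : ∀ {A} → A ⇒ A
    _∘_ : ∀ {A B C} → B ⇒ C → A ⇒ B → A ⇒ C
    identityˡ : ∀ {A B} {f : A ⇒ B} → id ∘ f ≡ f
    identityʳ : ∀ {A B} {f : A ⇒ B} → f ∘ id ≡ f
    assoc : ∀ {A B C D} {f : A ⇒ B} {g : B ⇒ C} {h : C ⇒ D} →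
            (h ∘ g) ∘ f ≡ h ∘ (g ∘ f)

record Functor {o ℓ o' ℓ'} (C : Category o ℓ) (D : Category o' ℓ')
       : Set (o ⊔ ℓ ⊔ o' ⊔ ℓ') where
  private
    module C = Category C
    module D = Category D
  field
    F₀ : C.Obj → D.Obj
    F₁ : ∀ {A B} → A C.⇒ B → F₀ A D.⇒ F₀ B
    identity : ∀ {A} → F₁ (C.id {A}) ≡ D.id
    homomorphism : ∀ {A B E} {f : A C.⇒ B} {g : B C.⇒ E} →
                   F₁ (g C.∘ f) ≡ F₁ g D.∘ F₁ f

module _ {o ℓ} (C : Category o ℓ) where
  open Category C

  IsIso : ∀ {A B} → A ⇒ B → Set ℓ
  IsIso {A} {B} f = Σ (B ⇒ A) λ g → (g ∘ f ≡ id) × (f ∘ g ≡ id)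

  IsMono : ∀ {A B} → A ⇒ B → Set (o ⊔ ℓ)
  IsMono {A} f = ∀ {X} (g h : X ⇒ A) → f ∘ g ≡ f ∘ h → g ≡ h

  IsEpi : ∀ {A B} → A ⇒ B → Set (o ⊔ ℓ)
  IsEpi {A} {B} f = ∀ {X} (g h : B ⇒ X) → g ∘ f ≡ h ∘ f → g ≡ h

  IsPushout : ∀ {A B E P} (f : A ⇒ B) (g : A ⇒ E) (i₁ : B ⇒ P) (i₂ : E ⇒ P)
              → Set (o ⊔ ℓ)
  IsPushout {A} {B} {E} {P} f g i₁ i₂ =
    (i₁ ∘ f ≡ i₂ ∘ g) ×
    (∀ {Q} (h₁ : B ⇒ Q) (h₂ : E ⇒ Q) → h₁ ∘ f ≡ h₂ ∘ g →
       Σ (P ⇒ Q) λ u → (u ∘ i₁ ≡ h₁) × (u ∘ i₂ ≡ h₂) ×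
         (∀ (v : P ⇒ Q) → v ∘ i₁ ≡ h₁ → v ∘ i₂ ≡ h₂ → v ≡ u))

  HasPushouts : Set (o ⊔ ℓ)
  HasPushouts = ∀ {A B E} (f : A ⇒ B) (g : A ⇒ E) →
    Σ Obj λ P → Σ (B ⇒ P) λ i₁ → Σ (E ⇒ P) λ i₂ → IsPushout f g i₁ i₂

  IsPullback : ∀ {A B E P} (f : A ⇒ E) (g : B ⇒ E) (p₁ : P ⇒ A) (p₂ : P ⇒ B)
               → Set (o ⊔ ℓ)
  IsPullback {A} {B} {E} {P} f g p₁ p₂ =
    (f ∘ p₁ ≡ g ∘ p₂) ×
    (∀ {Q} (h₁ : Q ⇒ A) (h₂ : Q ⇒ B) → f ∘ h₁ ≡ g ∘ h₂ →
       Σ (Q ⇒ P) λ u → (p₁ ∘ u ≡ h₁) × (p₂ ∘ u ≡ h₂) ×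
         (∀ (v : Q ⇒ P) → p₁ ∘ v ≡ h₁ → p₂ ∘ v ≡ h₂ → v ≡ u))

  HasPullbacks : Set (o ⊔ ℓ)
  HasPullbacks = ∀ {A B E} (f : A ⇒ E) (g : B ⇒ E) →
    Σ Obj λ P → Σ (P ⇒ A) λ p₁ → Σ (P ⇒ B) λ p₂ → IsPullback f g p₁ p₂

FullSub : ∀ {o ℓ p} (C : Category o ℓ) → (Category.Obj C → Set p)
          → Category (o ⊔ p) ℓ
FullSub C P = record
  { Obj = Σ Obj P
  ; _⇒_ = λ X Y → proj₁ X ⇒ proj₁ Y
  ; id = id
  ; _∘_ = _∘_
  ; identityˡ = identityˡ
  ; identityʳ = identityʳ
  ; assoc = assoc
  }
  where open Category C

record Preadditive {o ℓ} (C : Category o ℓ) : Set (o ⊔ ℓ) where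
  open Category C
  infixl 6 _+_
  field
    _+_ : ∀ {A B} → A ⇒ B → A ⇒ B → A ⇒ B
    0m : ∀ {A B} → A ⇒ B
    -_ : ∀ {A B} → A ⇒ B → A ⇒ B
    +-assoc : ∀ {A B} {f g h : A ⇒ B} → (f + g) + h ≡ f + (g + h)
    +-comm : ∀ {A B} {f g : A ⇒ B} → f + g ≡ g + f
    +-identityˡ : ∀ {A B} {f : A ⇒ B} → 0m + f ≡ f
    +-inverseˡ : ∀ {A B} {f : A ⇒ B} → (- f) + f ≡ 0m
    ∘-distribˡ : ∀ {A B E} {f g : A ⇒ B} {h : B ⇒ E} →
                 h ∘ (f + g) ≡ h ∘ f + h ∘ g
    ∘-distribʳ : ∀ {A B E} {f g : B ⇒ E} {h : A ⇒ B} →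
                 (f + g) ∘ h ≡ f ∘ h + g ∘ h

FullSubPre : ∀ {o ℓ p} {C : Category o ℓ} (P : Category.Obj C → Set p)
             → Preadditive C → Preadditive (FullSub C P)
FullSubPre P pre = record
  { _+_ = _+_ ; 0m = 0m ; -_ = -_
  ; +-assoc = +-assoc ; +-comm = +-comm ; +-identityˡ = +-identityˡ
  ; +-inverseˡ = +-inverseˡ ; ∘-distribˡ = ∘-distribˡ ; ∘-distribʳ = ∘-distribʳ }
  where open Preadditive pre

module _ {o ℓ} (C : Category o ℓ) (pre : Preadditive C) where
  open Category C
  open Preadditive pre

  IsZeroObject : Obj → Set (o ⊔ ℓ)
  IsZeroObject Z = ∀ A →
    (Σ (A ⇒ Z) λ u → ∀ v → v ≡ u) × (Σ (Z ⇒ A) λ u → ∀ v → v ≡ u)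

  IsBiproduct : ∀ {A B S} (i₁ : A ⇒ S) (i₂ : B ⇒ S) (p₁ : S ⇒ A) (p₂ : S ⇒ B)
                → Set ℓ
  IsBiproduct i₁ i₂ p₁ p₂ =
    (p₁ ∘ i₁ ≡ id) × (p₂ ∘ i₂ ≡ id) × (p₁ ∘ i₂ ≡ 0m) × (p₂ ∘ i₁ ≡ 0m) ×
    (i₁ ∘ p₁ + i₂ ∘ p₂ ≡ id)

  IsKernel : ∀ {K A B} (f : A ⇒ B) (k : K ⇒ A) → Set (o ⊔ ℓ)
  IsKernel {K} {A} f k = (f ∘ k ≡ 0m) ×
    (∀ {X} (h : X ⇒ A) → f ∘ h ≡ 0m →
       Σ (X ⇒ K) λ u → (k ∘ u ≡ h) × (∀ v → k ∘ v ≡ h → v ≡ u))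

  IsCokernel : ∀ {A B Q} (f : A ⇒ B) (c : B ⇒ Q) → Set (o ⊔ ℓ)
  IsCokernel {A} {B} {Q} f c = (c ∘ f ≡ 0m) ×
    (∀ {X} (h : B ⇒ X) → h ∘ f ≡ 0m →
       Σ (Q ⇒ X) λ u → (u ∘ c ≡ h) × (∀ v → v ∘ c ≡ h → v ≡ u))

  record IsAdditive : Set (o ⊔ ℓ) where
    field
      zero : Σ Obj IsZeroObject
      biproduct : ∀ A B → Σ Obj λ S → Σ (A ⇒ S) λ i₁ → Σ (B ⇒ S) λ i₂ →
                  Σ (S ⇒ A) λ p₁ → Σ (S ⇒ B) λ p₂ → IsBiproduct i₁ i₂ p₁ p₂

  record IsAbelian : Set (o ⊔ ℓ) where
    field
      additive : IsAdditive
      kernel : ∀ {A B} (f : A ⇒ B) → Σ Obj λ K → Σ (K ⇒ A) λ k → IsKernel f k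
      cokernel : ∀ {A B} (f : A ⇒ B) → Σ Obj λ Q → Σ (B ⇒ Q) λ c → IsCokernel f c
      mono-is-kernel : ∀ {A B} (m : A ⇒ B) → IsMono C m →
                       Σ Obj λ E → Σ (B ⇒ E) λ f → IsKernel f m
      epi-is-cokernel : ∀ {A B} (e : A ⇒ B) → IsEpi C e →
                        Σ Obj λ E → Σ (E ⇒ A) λ f → IsCokernel f e

module _ {o ℓ o' ℓ'} {C : Category o ℓ} {D : Category o' ℓ'} where
  private
    module C = Category C
    module D = Category D

  IsAdditiveFunctor : Functor C D → Preadditive C → Preadditive D → Set (o ⊔ ℓ ⊔ ℓ')
  IsAdditiveFunctor F P Q = ∀ {A B} (f g : A C.⇒ B) →
    F₁ (f P+ g) ≡ F₁ f Q+ F₁ g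
    where
      open Functor F
      open Preadditive P renaming (_+_ to _P+_)
      open Preadditive Q renaming (_+_ to _Q+_)

  -- exact: sends short exact sequences 0 → X → Y → Z → 0
  -- (f a kernel of g and g a cokernel of f) to short exact sequences
  IsExact : Functor C D → Preadditive C → Preadditive D → Set (o ⊔ ℓ ⊔ o' ⊔ ℓ')
  IsExact F P Q = ∀ {X Y Z} (f : X C.⇒ Y) (g : Y C.⇒ Z) →
    IsKernel C P g f → IsCokernel C P f g →
    IsKernel D Q (F₁ g) (F₁ f) × IsCokernel D Q (F₁ f) (F₁ g)
    where open Functor F

module _ {o ℓ o' ℓ'} {C : Category o ℓ} {A : Category o' ℓ'} (T : Functor C A) where
  private
    module C = Category C
    module A = Category A
  open Functor T

  Ax0 : Set (o ⊔ ℓ ⊔ o' ⊔ ℓ')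
  Ax0 = ∀ (X : C.Obj) (A' : A.Obj) (f : F₀ X A.⇒ A') → IsIso A f →
    Σ C.Obj λ X' → Σ (F₀ X' ≡ A') λ p → Σ (X C.⇒ X') λ g →
      IsIso C g × (subst (λ B → F₀ X A.⇒ B) p (F₁ g) ≡ f)

  Ax1 : Set (o ⊔ ℓ ⊔ ℓ')
  Ax1 = ∀ {X Y} (g h : X C.⇒ Y) → F₁ g ≡ F₁ h → g ≡ h

  Ax2 : Set (o ⊔ ℓ ⊔ o' ⊔ ℓ')
  Ax2 = HasPushouts C × HasPushouts A ×
    (∀ {X Y Z P} (f : X C.⇒ Y) (g : X C.⇒ Z) (i₁ : Y C.⇒ P) (i₂ : Z C.⇒ P) →
       IsPushout C f g i₁ i₂ → IsPushout A (F₁ f) (F₁ g) (F₁ i₁) (F₁ i₂))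

  Ax2* : Set (o ⊔ ℓ ⊔ o' ⊔ ℓ')
  Ax2* = HasPullbacks C × HasPullbacks A ×
    (∀ {X Y Z P} (f : X C.⇒ Z) (g : Y C.⇒ Z) (p₁ : P C.⇒ X) (p₂ : P C.⇒ Y) →
       IsPullback C f g p₁ p₂ → IsPullback A (F₁ f) (F₁ g) (F₁ p₁) (F₁ p₂))

  FibreObj : A.Obj → Set (o ⊔ ℓ')
  FibreObj B = Σ C.Obj λ X → Σ (F₀ X A.⇒ B) λ f → IsIso A f

  FibreHom : ∀ {B} → FibreObj B → FibreObj B → Set (ℓ ⊔ ℓ')
  FibreHom (X , f , _) (X' , f' , _) = Σ (X C.⇒ X') λ g → f ≡ f' A.∘ F₁ g

  IsFinalInFibre : ∀ {B} → FibreObj B → Set (o ⊔ ℓ ⊔ ℓ')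
  IsFinalInFibre {B} F = ∀ (E : FibreObj B) →
    Σ (FibreHom E F) λ h → ∀ (h' : FibreHom E F) → proj₁ h' ≡ proj₁ h

  Ax3 : Set (o ⊔ ℓ ⊔ o' ⊔ ℓ')
  Ax3 = ∀ (B : A.Obj) → (¬ FibreObj B) ⊎ (Σ (FibreObj B) IsFinalInFibre)

  Ax5 : Preadditive C → Preadditive A → Set (o ⊔ ℓ ⊔ o' ⊔ ℓ')
  Ax5 preC preA = IsAdditive C preC × IsAbelian A preA × IsAdditiveFunctor T preC preA

  -- C ∈ Max(C)  iff  (C , id_{T C}) is a final object of F_{T C}
  IsMax : C.Obj → Set (o ⊔ ℓ ⊔ ℓ')
  IsMax X = IsFinalInFibre (X , A.id , A.id , A.identityˡ , A.identityˡ)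

  MaxCat : Category (o ⊔ ℓ ⊔ ℓ') ℓ
  MaxCat = FullSub C IsMax

  MaxPre : Preadditive C → Preadditive MaxCat
  MaxPre = FullSubPre IsMax

  TMax : Functor MaxCat A
  TMax = record
    { F₀ = λ X → F₀ (proj₁ X)
    ; F₁ = F₁
    ; identity = identity
    ; homomorphism = homomorphism
    }

module Submission where

open import Level using (_⊔_)
open import Defs
open import Data.Product using (Σ; _×_; _,_; proj₁; proj₂)
open import Data.Sum using (inj₁; inj₂)
open import Data.Empty using (⊥-elim)
open import Relation.Binary.PropositionalEquality

-- (Ax3) gives every X a maximal hull u : X → X̂ (X̂ maximal, T u invertible):
-- X̂ is the final object of the fibre of T X.  By (Ax1) maximal objects lift
-- isomorphisms into their image, so T reflects isomorphisms out of them, and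
-- with (Ax2) every morphism X → M into a maximal M extends along a hull of X.
-- So constructions of C move into Max(C) by taking hulls, keeping their image:
--   * kernel of f: hull of the pullback of f along 0 (Ax2*); cokernel of f:
--     hull composed with the pushout of f along 0 (Ax2); T maps both to
--     (co)kernels in A, and any (co)kernel of Max(C) is isomorphic to these;
--   * zero object and biproducts: those of C, made maximal by hulls.
-- A mono (epi) of Max(C) has kernel pair (cokernel pair) with equal legs, so T
-- sends it to a mono (epi) of the abelian A, hence to the kernel (cokernel) of
-- its cokernel (kernel); as T reflects (co)kernels, so is the original one.

module CategoryFacts {o ℓ} (C : Category o ℓ) where
  open Category C
  open ≡-Reasoning

  pullʳ : ∀ {W X Y Z} {f : W ⇒ X} {g : X ⇒ Y} {k : W ⇒ Y} {h : Y ⇒ Z} →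
          g ∘ f ≡ k → (h ∘ g) ∘ f ≡ h ∘ k
  pullʳ {h = h} e = trans assoc (cong (h ∘_) e)

  pullˡ : ∀ {W X Y Z} {f : X ⇒ Y} {g : W ⇒ X} {k : W ⇒ Y} {h : Z ⇒ W} →
          f ∘ g ≡ k → f ∘ (g ∘ h) ≡ k ∘ h
  pullˡ {h = h} e = trans (sym assoc) (cong (_∘ h) e)

  id-iso : ∀ {X} → IsIso C (id {X})
  id-iso = id , identityˡ , identityˡ

  inverse-iso : ∀ {X Y} {f : X ⇒ Y} (fi : IsIso C f) → IsIso C (proj₁ fi)
  inverse-iso {f = f} (_ , l , r) = f , r , l

  ∘-iso : ∀ {X Y Z} {f : X ⇒ Y} {g : Y ⇒ Z} → IsIso C f → IsIso C g → IsIso C (g ∘ f)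
  ∘-iso {f = f} {g} (f⁻ , fl , fr) (g⁻ , gl , gr) = f⁻ ∘ g⁻ , left , right
    where
      left : (f⁻ ∘ g⁻) ∘ (g ∘ f) ≡ id
      left = begin
        (f⁻ ∘ g⁻) ∘ (g ∘ f) ≡⟨ pullʳ (pullˡ gl) ⟩
        f⁻ ∘ (id ∘ f)       ≡⟨ cong (f⁻ ∘_) identityˡ ⟩
        f⁻ ∘ f              ≡⟨ fl ⟩
        id                  ∎
      right : (g ∘ f) ∘ (f⁻ ∘ g⁻) ≡ id
      right = begin
        (g ∘ f) ∘ (f⁻ ∘ g⁻) ≡⟨ pullʳ (pullˡ fr) ⟩
        g ∘ (id ∘ g⁻)       ≡⟨ cong (g ∘_) identityˡ ⟩
        g ∘ g⁻              ≡⟨ gr ⟩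
        id                  ∎

  iso-cancelˡ : ∀ {X Y Z} {f : Y ⇒ Z} {a b : X ⇒ Y} → IsIso C f → f ∘ a ≡ f ∘ b → a ≡ b
  iso-cancelˡ {f = f} {a} {b} (f⁻ , l , _) e = begin
    a             ≡⟨ sym identityˡ ⟩
    id ∘ a        ≡⟨ cong (_∘ a) (sym l) ⟩
    (f⁻ ∘ f) ∘ a  ≡⟨ pullʳ e ⟩
    f⁻ ∘ (f ∘ b)  ≡⟨ pullˡ l ⟩
    id ∘ b        ≡⟨ identityˡ ⟩
    b             ∎

  iso-epi : ∀ {X Y} {f : X ⇒ Y} → IsIso C f → IsEpi C f
  iso-epi {f = f} (f⁻ , _ , r) a b e = begin
    a             ≡⟨ sym identityʳ ⟩
    a ∘ id        ≡⟨ cong (a ∘_) (sym r) ⟩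
    a ∘ (f ∘ f⁻)  ≡⟨ pullˡ e ⟩
    (b ∘ f) ∘ f⁻  ≡⟨ pullʳ r ⟩
    b ∘ id        ≡⟨ identityʳ ⟩
    b             ∎

  section-of-iso : ∀ {X Y} {f : X ⇒ Y} {g : Y ⇒ X} → IsIso C f → f ∘ g ≡ id → IsIso C g
  section-of-iso {f = f} {g} fi e = f , e , iso-cancelˡ fi (begin
    f ∘ (g ∘ f)  ≡⟨ pullˡ e ⟩
    id ∘ f       ≡⟨ identityˡ ⟩
    f            ≡⟨ sym identityʳ ⟩
    f ∘ id       ∎)

  ∘-epi : ∀ {X Y Z} {f : X ⇒ Y} {g : Y ⇒ Z} → IsEpi C f → IsEpi C g → IsEpi C (g ∘ f)
  ∘-epi ef eg a b e = eg a b (ef _ _ (trans assoc (trans e (sym assoc))))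

  pushout-of-iso : ∀ {X Y Z P} {f : X ⇒ Y} {g : X ⇒ Z} {i₁ : Y ⇒ P} {i₂ : Z ⇒ P}
    → IsPushout C f g i₁ i₂ → IsIso C f → IsIso C i₂
  pushout-of-iso {f = f} {g} {i₁} {i₂} (comm , univ) (f⁻ , l , r)
    with univ (g ∘ f⁻) id (trans (pullʳ l) (trans identityʳ (sym identityˡ)))
       | univ i₁ i₂ comm
  ... | w , wi₁ , wi₂ , _ | _ , _ , _ , unique =
    w , wi₂ , trans (unique (i₂ ∘ w) i₂w∘i₁ i₂w∘i₂) (sym (unique id identityˡ identityˡ))
    where
      i₂w∘i₁ : (i₂ ∘ w) ∘ i₁ ≡ i₁
      i₂w∘i₁ = begin
        (i₂ ∘ w) ∘ i₁  ≡⟨ pullʳ wi₁ ⟩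
        i₂ ∘ (g ∘ f⁻)  ≡⟨ pullˡ (sym comm) ⟩
        (i₁ ∘ f) ∘ f⁻  ≡⟨ pullʳ r ⟩
        i₁ ∘ id        ≡⟨ identityʳ ⟩
        i₁             ∎
      i₂w∘i₂ : (i₂ ∘ w) ∘ i₂ ≡ i₂
      i₂w∘i₂ = trans (pullʳ wi₂) identityʳ

  kernel-pair-mono : ∀ {X Y P} {m : X ⇒ Y} {p₁ p₂ : P ⇒ X} →
    IsPullback C m m p₁ p₂ → p₁ ≡ p₂ → IsMono C m
  kernel-pair-mono {p₁ = p₁} {p₂} (_ , univ) p₁≡p₂ a b ma≡mb =
    let (w , p₁w≡a , p₂w≡b , _) = univ a b ma≡mb
    in trans (sym p₁w≡a) (trans (cong (_∘ w) p₁≡p₂) p₂w≡b)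

  cokernel-pair-epi : ∀ {X Y Q} {e : X ⇒ Y} {i₁ i₂ : Y ⇒ Q} →
    IsPushout C e e i₁ i₂ → i₁ ≡ i₂ → IsEpi C e
  cokernel-pair-epi {i₁ = i₁} {i₂} (_ , univ) i₁≡i₂ a b ae≡be =
    let (w , wi₁≡a , wi₂≡b , _) = univ a b ae≡be
    in trans (sym wi₁≡a) (trans (cong (w ∘_) i₁≡i₂) wi₂≡b)

module PreadditiveFacts {o ℓ} (C : Category o ℓ) (pre : Preadditive C) where
  open Category C
  open Preadditive pre
  open CategoryFacts C
  open ≡-Reasoning

  idempotent-is-zero : ∀ {X Y} {x : X ⇒ Y} → x + x ≡ x → x ≡ 0m
  idempotent-is-zero {x = x} e = begin
    x                ≡⟨ sym +-identityˡ ⟩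
    0m + x           ≡⟨ cong (_+ x) (sym +-inverseˡ) ⟩
    ((- x) + x) + x  ≡⟨ +-assoc ⟩
    (- x) + (x + x)  ≡⟨ cong ((- x) +_) e ⟩
    (- x) + x        ≡⟨ +-inverseˡ ⟩
    0m               ∎

  ∘-zeroʳ : ∀ {X Y Z} {f : Y ⇒ Z} → f ∘ 0m {X} {Y} ≡ 0m
  ∘-zeroʳ {f = f} = idempotent-is-zero (trans (sym ∘-distribˡ) (cong (f ∘_) +-identityˡ))

  ∘-zeroˡ : ∀ {X Y Z} {f : X ⇒ Y} → 0m {Y} {Z} ∘ f ≡ 0m
  ∘-zeroˡ {f = f} = idempotent-is-zero (trans (sym ∘-distribʳ) (cong (_∘ f) +-identityˡ))

  zero-object-from-id : ∀ {Z} → id {Z} ≡ 0m → IsZeroObject C pre Z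
  zero-object-from-id e X =
    (0m , λ v → trans (sym identityˡ) (trans (cong (_∘ v) e) ∘-zeroˡ)) ,
    (0m , λ v → trans (sym identityʳ) (trans (cong (v ∘_) e) ∘-zeroʳ))

  into-zero-unique : ∀ {Z} → IsZeroObject C pre Z → ∀ {X} (a b : X ⇒ Z) → a ≡ b
  into-zero-unique z {X} a b = trans (proj₂ (proj₁ (z X)) a) (sym (proj₂ (proj₁ (z X)) b))

  out-of-zero-unique : ∀ {Z} → IsZeroObject C pre Z → ∀ {X} (a b : Z ⇒ X) → a ≡ b
  out-of-zero-unique z {X} a b = trans (proj₂ (proj₂ (z X)) a) (sym (proj₂ (proj₂ (z X)) b))

  through-zero : ∀ {Z X Y} → IsZeroObject C pre Z → (a : Z ⇒ Y) (b : X ⇒ Z) → a ∘ b ≡ 0m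
  through-zero z a b = trans (cong (_∘ b) (out-of-zero-unique z a 0m)) ∘-zeroˡ

  pullback-from-zero-is-kernel : ∀ {M N Z P} {f : M ⇒ N} {g : Z ⇒ N} {p₁ : P ⇒ M} {p₂ : P ⇒ Z}
    → IsZeroObject C pre Z → IsPullback C f g p₁ p₂ → IsKernel C pre f p₁
  pullback-from-zero-is-kernel {g = g} {p₂ = p₂} z (comm , univ) =
    trans comm (through-zero z g p₂) , λ h fh≡0 →
      let (w , p₁w , _ , unique) = univ h 0m (trans fh≡0 (sym ∘-zeroʳ))
      in w , p₁w , λ v p₁v → unique v p₁v (into-zero-unique z _ _)

  pushout-to-zero-is-cokernel : ∀ {M N Z Q} {f : M ⇒ N} {g : M ⇒ Z} {i₁ : N ⇒ Q} {i₂ : Z ⇒ Q}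
    → IsZeroObject C pre Z → IsPushout C f g i₁ i₂ → IsCokernel C pre f i₁
  pushout-to-zero-is-cokernel {g = g} {i₂ = i₂} z (comm , univ) =
    trans comm (through-zero z i₂ g) , λ h hf≡0 →
      let (w , wi₁ , _ , unique) = univ h 0m (trans hf≡0 (sym ∘-zeroˡ))
      in w , wi₁ , λ v vi₁ → unique v vi₁ (out-of-zero-unique z _ _)

  kernel-mono : ∀ {K X Y} {f : X ⇒ Y} {k : K ⇒ X} → IsKernel C pre f k → IsMono C k
  kernel-mono {k = k} (fk≡0 , univ) a b e =
    let (_ , _ , unique) = univ (k ∘ a) (trans (pullˡ fk≡0) ∘-zeroˡ)
    in trans (unique a refl) (sym (unique b (sym e)))

  cokernel-epi : ∀ {X Y Q} {f : X ⇒ Y} {c : Y ⇒ Q} → IsCokernel C pre f c → IsEpi C c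
  cokernel-epi {c = c} (cf≡0 , univ) a b e =
    let (_ , _ , unique) = univ (a ∘ c) (trans (pullʳ cf≡0) ∘-zeroʳ)
    in trans (unique a refl) (sym (unique b (sym e)))

  kernel-∘-iso : ∀ {K K' X Y} {f : X ⇒ Y} {k : K ⇒ X} {φ : K' ⇒ K}
    → IsKernel C pre f k → IsIso C φ → IsKernel C pre f (k ∘ φ)
  kernel-∘-iso {k = k} {φ} (fk≡0 , univ) (φ⁻ , l , r) =
    trans (pullˡ fk≡0) ∘-zeroˡ , λ h fh≡0 →
      let (w , kw , unique) = univ h fh≡0
      in φ⁻ ∘ w ,
         trans (pullʳ (trans (pullˡ r) identityˡ)) kw ,
         λ v kφv → begin
           v               ≡⟨ sym identityˡ ⟩
           id ∘ v          ≡⟨ cong (_∘ v) (sym l) ⟩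
           (φ⁻ ∘ φ) ∘ v    ≡⟨ pullʳ (unique (φ ∘ v) (trans (sym assoc) kφv)) ⟩
           φ⁻ ∘ w          ∎

  kernel-cancel-iso : ∀ {K K' X Y} {f : X ⇒ Y} {k : K ⇒ X} {φ : K' ⇒ K}
    → IsKernel C pre f (k ∘ φ) → IsIso C φ → IsKernel C pre f k
  kernel-cancel-iso {f = f} {k} {φ} kφ-kernel φ-iso@(_ , _ , r) =
    subst (IsKernel C pre f) (trans (pullʳ r) identityʳ)
          (kernel-∘-iso kφ-kernel (inverse-iso φ-iso))

  cokernel-∘-iso : ∀ {Q Q' X Y} {f : X ⇒ Y} {c : Y ⇒ Q} {φ : Q ⇒ Q'}
    → IsCokernel C pre f c → IsIso C φ → IsCokernel C pre f (φ ∘ c)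
  cokernel-∘-iso {c = c} {φ} (cf≡0 , univ) (φ⁻ , l , r) =
    trans (pullʳ cf≡0) ∘-zeroʳ , λ h hf≡0 →
      let (w , wc , unique) = univ h hf≡0
      in w ∘ φ⁻ ,
         trans (pullʳ (trans (pullˡ l) identityˡ)) wc ,
         λ v vφc → begin
           v               ≡⟨ sym identityʳ ⟩
           v ∘ id          ≡⟨ cong (v ∘_) (sym r) ⟩
           v ∘ (φ ∘ φ⁻)    ≡⟨ pullˡ (unique (v ∘ φ) (trans assoc vφc)) ⟩
           w ∘ φ⁻          ∎

  kernel-unique : ∀ {K K' X Y} {g : X ⇒ Y} {k : K ⇒ X} {k' : K' ⇒ X}
    → IsKernel C pre g k → IsKernel C pre g k' → Σ (K' ⇒ K) λ φ → (k' ≡ k ∘ φ) × IsIso C φ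
  kernel-unique {k = k} {k'} ker@(gk≡0 , univ) ker'@(gk'≡0 , univ') =
    let (φ , kφ , _) = univ k' gk'≡0
        (ψ , k'ψ , _) = univ' k gk≡0
    in φ , sym kφ , ψ ,
       kernel-mono ker' (ψ ∘ φ) id (trans (pullˡ k'ψ) (trans kφ (sym identityʳ))) ,
       kernel-mono ker (φ ∘ ψ) id (trans (pullˡ kφ) (trans k'ψ (sym identityʳ)))

  cokernel-unique : ∀ {Q Q' X Y} {f : X ⇒ Y} {c : Y ⇒ Q} {c' : Y ⇒ Q'}
    → IsCokernel C pre f c → IsCokernel C pre f c' → Σ (Q ⇒ Q') λ φ → (c' ≡ φ ∘ c) × IsIso C φ
  cokernel-unique {c = c} {c'} cok@(cf≡0 , univ) cok'@(c'f≡0 , univ') =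
    let (φ , φc , _) = univ c' c'f≡0
        (ψ , ψc' , _) = univ' c cf≡0
    in φ , sym φc , ψ ,
       cokernel-epi cok (ψ ∘ φ) id (trans (pullʳ φc) (trans ψc' (sym identityˡ))) ,
       cokernel-epi cok' (φ ∘ ψ) id (trans (pullʳ ψc') (trans φc (sym identityˡ)))

  kernel-of-its-cokernel : ∀ {K X Y Z} {e : X ⇒ Z} {k : K ⇒ X} {c : X ⇒ Y}
    → IsKernel C pre e k → IsCokernel C pre k c → IsKernel C pre c k
  kernel-of-its-cokernel (ek≡0 , univ) (ck≡0 , univ') = ck≡0 , λ h ch≡0 →
    let (_ , e'c , _) = univ' _ ek≡0
    in univ h (trans (cong (_∘ h) (sym e'c)) (trans (pullʳ ch≡0) ∘-zeroʳ))

  cokernel-of-its-kernel : ∀ {K X Y Z} {e : Z ⇒ X} {k : K ⇒ X} {c : X ⇒ Y}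
    → IsCokernel C pre e c → IsKernel C pre c k → IsCokernel C pre k c
  cokernel-of-its-kernel (ce≡0 , univ) (ck≡0 , univ') = ck≡0 , λ h hk≡0 →
    let (_ , ke' , _) = univ' _ ce≡0
    in univ h (trans (cong (h ∘_) (sym ke')) (trans (pullˡ hk≡0) ∘-zeroˡ))

restrict-kernel : ∀ {o ℓ p} (C : Category o ℓ) (pre : Preadditive C)
  (P : Category.Obj C → Set p) {K X Y : Σ (Category.Obj C) P}
  {f : Category._⇒_ C (proj₁ X) (proj₁ Y)} {k : Category._⇒_ C (proj₁ K) (proj₁ X)} →
  IsKernel C pre f k → IsKernel (FullSub C P) (FullSubPre P pre) {K} {X} {Y} f k
restrict-kernel C pre P (fk≡0 , univ) = fk≡0 , λ h → univ h

module FunctorFacts {o ℓ o' ℓ'} {C : Category o ℓ} {D : Category o' ℓ'} (F : Functor C D) where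
  private
    module C = Category C
    module D = Category D
  open Functor F

  F-resp : ∀ {X Y Z} {f : X C.⇒ Y} {g : Y C.⇒ Z} {h : X C.⇒ Z} →
           g C.∘ f ≡ h → F₁ g D.∘ F₁ f ≡ F₁ h
  F-resp e = trans (sym homomorphism) (cong F₁ e)

  F-iso : ∀ {X Y} {f : X C.⇒ Y} → IsIso C f → IsIso D (F₁ f)
  F-iso (g , l , r) = F₁ g , trans (F-resp l) identity , trans (F-resp r) identity

  faithful-reflects-mono : Ax1 F → ∀ {X Y} {m : X C.⇒ Y} → IsMono D (F₁ m) → IsMono C m
  faithful-reflects-mono faithful Fm-mono a b e =
    faithful a b (Fm-mono (F₁ a) (F₁ b) (trans (F-resp e) homomorphism))

  faithful-reflects-epi : Ax1 F → ∀ {X Y} {m : X C.⇒ Y} → IsEpi D (F₁ m) → IsEpi C m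
  faithful-reflects-epi faithful Fm-epi a b e =
    faithful a b (Fm-epi (F₁ a) (F₁ b) (trans (F-resp e) homomorphism))

  module Additive (preC : Preadditive C) (preD : Preadditive D)
                  (additive : IsAdditiveFunctor F preC preD) where
    private
      module PC = Preadditive preC
      module PD = Preadditive preD
    open PreadditiveFacts C preC
      using (into-zero-unique)
    open PreadditiveFacts D preD
      using (idempotent-is-zero; zero-object-from-id)

    F-zero : ∀ {X Y} → F₁ (PC.0m {X} {Y}) ≡ PD.0m
    F-zero = idempotent-is-zero (trans (sym (additive PC.0m PC.0m)) (cong F₁ PC.+-identityˡ))

    F-zero-object : ∀ {Z} → IsZeroObject C preC Z → IsZeroObject D preD (F₀ Z)
    F-zero-object z =
      zero-object-from-id (trans (sym identity) (trans (cong F₁ (into-zero-unique z C.id PC.0m)) F-zero))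

module MaximalObjects {o ℓ o' ℓ'} {C : Category o ℓ} {A : Category o' ℓ'}
                      (T : Functor C A) (faithful : Ax1 T) where
  private
    module C = Category C
    module A = Category A
    module CF = CategoryFacts C
    module AF = CategoryFacts A
  open Functor T
  open FunctorFacts T
  open ≡-Reasoning

  -- M is maximal as soon as every isomorphism T E ≅ T M is the image of a
  -- morphism E → M (uniqueness of the lift is automatic by faithfulness)
  isMax-intro : ∀ {M} →
    (∀ E (e : F₀ E A.⇒ F₀ M) → IsIso A e → Σ (E C.⇒ M) λ h → F₁ h ≡ e) → IsMax T M
  isMax-intro lifts (E , e , e-iso) =
    let (h , Fh≡e) = lifts E e e-iso
    in (h , trans (sym Fh≡e) (sym A.identityˡ)) ,
       λ (h' , e≡Fh') → faithful h' h (trans (sym A.identityˡ) (trans (sym e≡Fh') (sym Fh≡e)))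

  lift : ∀ {X M} → IsMax T M → (a : F₀ X A.⇒ F₀ M) → IsIso A a →
         Σ (X C.⇒ M) λ g → F₁ g ≡ a
  lift {X} M-max a a-iso =
    let ((g , a≡id∘Fg) , _) = M-max (X , a , a-iso)
    in g , sym (trans a≡id∘Fg A.identityˡ)

  reflects-iso : ∀ {M N} {g : M C.⇒ N} → IsMax T M → IsIso A (F₁ g) → IsIso C g
  reflects-iso {g = g} M-max Fg-iso@(g⁻ , l , r) =
    let (h , Fh≡g⁻) = lift M-max g⁻ (AF.inverse-iso Fg-iso)
    in h ,
       faithful _ _ (trans homomorphism (trans (cong (A._∘ F₁ g) Fh≡g⁻) (trans l (sym identity)))) ,
       faithful _ _ (trans homomorphism (trans (cong (F₁ g A.∘_) Fh≡g⁻) (trans r (sym identity))))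

  inverted-is-epi : ∀ {X Y} {u : X C.⇒ Y} → IsIso A (F₁ u) → IsEpi C u
  inverted-is-epi Fu-iso = faithful-reflects-epi faithful (AF.iso-epi Fu-iso)

  -- if u : S → M is inverted by T, M is maximal and u has a retraction,
  -- then S is maximal (isomorphisms into T S lift through M)
  retract-is-max : ∀ {S M} {u : S C.⇒ M} {r : M C.⇒ S} →
    IsMax T M → IsIso A (F₁ u) → r C.∘ u ≡ C.id → IsMax T S
  retract-is-max {u = u} {r} M-max Fu-iso ru≡id = isMax-intro λ E e e-iso →
    let (h , Fh≡Fu∘e) = lift M-max (F₁ u A.∘ e) (AF.∘-iso e-iso Fu-iso)
    in r C.∘ h , (begin
      F₁ (r C.∘ h)           ≡⟨ homomorphism ⟩
      F₁ r A.∘ F₁ h          ≡⟨ cong (F₁ r A.∘_) Fh≡Fu∘e ⟩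
      F₁ r A.∘ (F₁ u A.∘ e)  ≡⟨ AF.pullˡ (trans (F-resp ru≡id) identity) ⟩
      A.id A.∘ e             ≡⟨ A.identityˡ ⟩
      e                      ∎)

  record Hull (X : C.Obj) : Set (o ⊔ ℓ ⊔ ℓ') where
    field
      obj : C.Obj
      obj-max : IsMax T obj
      unit : X C.⇒ obj
      unit-iso : IsIso A (F₁ unit)

  -- (Ax3): the final object (X̂ , ψ) of the (non-empty) fibre of T X gives a
  -- hull of X: X̂ is maximal, and the unit X → X̂ satisfies ψ ∘ T unit = id
  hull : Ax3 T → ∀ X → Hull X
  hull ax3 X with ax3 (F₀ X)
  ... | inj₁ empty = ⊥-elim (empty (X , A.id , AF.id-iso))
  ... | inj₂ ((X̂ , ψ , ψ-iso) , final) with final (X , A.id , AF.id-iso)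
  ... | (unit , id≡ψFu) , _ = record
    { obj = X̂
    ; obj-max = isMax-intro λ E e e-iso →
        let ((h , ψe≡ψFh) , _) = final (E , ψ A.∘ e , AF.∘-iso e-iso ψ-iso)
        in h , sym (AF.iso-cancelˡ ψ-iso ψe≡ψFh)
    ; unit = unit
    ; unit-iso = AF.section-of-iso ψ-iso (sym id≡ψFu)
    }

  -- Push out u and g; T of the pushout square is a pushout, so T i₂ is
  -- invertible, hence so is i₂ (its source M is maximal); then i₂⁻¹ ∘ i₁
  -- extends g.
  extend : Ax2 T → ∀ {X Y M} → IsMax T M → (u : X C.⇒ Y) → IsIso A (F₁ u) →
           (g : X C.⇒ M) → Σ (Y C.⇒ M) λ g' → g' C.∘ u ≡ g
  extend (pushouts , _ , preserves) M-max u Fu-iso g with pushouts u g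
  ... | _ , i₁ , i₂ , po@(i₁u≡i₂g , _)
      with reflects-iso M-max (AF.pushout-of-iso (preserves u g i₁ i₂ po) Fu-iso)
  ... | i₂⁻ , i₂⁻i₂≡id , _ = i₂⁻ C.∘ i₁ , (begin
      (i₂⁻ C.∘ i₁) C.∘ u  ≡⟨ CF.pullʳ i₁u≡i₂g ⟩
      i₂⁻ C.∘ (i₂ C.∘ g)  ≡⟨ CF.pullˡ i₂⁻i₂≡id ⟩
      C.id C.∘ g          ≡⟨ C.identityˡ ⟩
      g                   ∎)

module Main {o ℓ o' ℓ'} {C : Category o ℓ} {A : Category o' ℓ'} (T : Functor C A)
  (faithful : Ax1 T) (ax2 : Ax2 T) (ax3 : Ax3 T) (ax2* : Ax2* T)
  (preC : Preadditive C) (preA : Preadditive A) (ax5 : Ax5 T preC preA) where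
  private
    module C = Category C
    module A = Category A
    module PC = Preadditive preC
    module CF = CategoryFacts C
    module AF = CategoryFacts A
    module CP = PreadditiveFacts C preC
    module AP = PreadditiveFacts A preA
  open Functor T
  open FunctorFacts T
  open MaximalObjects T faithful
  open ≡-Reasoning

  Max : Category (o ⊔ ℓ ⊔ ℓ') ℓ
  Max = MaxCat T

  MaxP : Preadditive Max
  MaxP = MaxPre T preC

  private
    module MP = PreadditiveFacts Max MaxP

  MObj : Set (o ⊔ ℓ ⊔ ℓ')
  MObj = Category.Obj Max

  ∣_∣ : MObj → C.Obj
  ∣_∣ = proj₁

  additiveC : IsAdditive C preC
  additiveC = proj₁ ax5

  abelianA : IsAbelian A preA
  abelianA = proj₁ (proj₂ ax5)

  open Additive preC preA (proj₂ (proj₂ ax5))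

  Z : C.Obj
  Z = proj₁ (IsAdditive.zero additiveC)

  Z-zero : IsZeroObject C preC Z
  Z-zero = proj₂ (IsAdditive.zero additiveC)

  hullObj : C.Obj → MObj
  hullObj X = Hull.obj (hull ax3 X) , Hull.obj-max (hull ax3 X)

  -- kernels in Max(C), preserved by T: the hull of the pullback of f along 0 → N
  record MaxKernel {M N : MObj} (f : ∣ M ∣ C.⇒ ∣ N ∣) : Set (o ⊔ ℓ ⊔ o' ⊔ ℓ') where
    field
      obj : MObj
      mor : ∣ obj ∣ C.⇒ ∣ M ∣
      isKernel : IsKernel Max MaxP {obj} {M} {N} f mor
      T-isKernel : IsKernel A preA (F₁ f) (F₁ mor)

  maxKernel : ∀ {M N : MObj} (f : ∣ M ∣ C.⇒ ∣ N ∣) → MaxKernel {M} {N} f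
  maxKernel {M} {N} f with proj₁ ax2* f (PC.0m {Z} {∣ N ∣})
  ... | P , p₁ , p₂ , pb = record
    { obj = hullObj P
    ; mor = k
    ; isKernel = restrict-kernel C preC (IsMax T) {hullObj P} {M} {N} k-kernel
    ; T-isKernel = Tk-kernel
    }
    where
      open Hull (hull ax3 P)
      p₁-kernel : IsKernel C preC f p₁
      p₁-kernel = CP.pullback-from-zero-is-kernel Z-zero pb
      Tp₁-kernel : IsKernel A preA (F₁ f) (F₁ p₁)
      Tp₁-kernel = AP.pullback-from-zero-is-kernel (F-zero-object Z-zero)
                     (proj₂ (proj₂ ax2*) _ _ p₁ p₂ pb)
      k : obj C.⇒ ∣ M ∣
      k = proj₁ (extend ax2 (proj₂ M) unit unit-iso p₁)
      k∘unit≡p₁ : k C.∘ unit ≡ p₁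
      k∘unit≡p₁ = proj₂ (extend ax2 (proj₂ M) unit unit-iso p₁)
      Tk-kernel : IsKernel A preA (F₁ f) (F₁ k)
      Tk-kernel = AP.kernel-cancel-iso
        (subst (IsKernel A preA (F₁ f)) (sym (F-resp k∘unit≡p₁)) Tp₁-kernel) unit-iso
      k-mono : IsMono C k
      k-mono = faithful-reflects-mono faithful (AP.kernel-mono Tk-kernel)
      -- k is even a kernel of f in C: everything factors through p₁ = k ∘ unit
      k-kernel : IsKernel C preC f k
      k-kernel = inverted-is-epi unit-iso _ _ fk∘unit≡0∘unit , λ h fh≡0 →
        let (w , p₁w≡h , _) = proj₂ p₁-kernel h fh≡0
            kuw≡h = trans (CF.pullˡ k∘unit≡p₁) p₁w≡h
        in unit C.∘ w , kuw≡h , λ v kv≡h → k-mono v _ (trans kv≡h (sym kuw≡h))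
        where
          fk∘unit≡0∘unit : (f C.∘ k) C.∘ unit ≡ PC.0m C.∘ unit
          fk∘unit≡0∘unit = trans (CF.pullʳ k∘unit≡p₁) (trans (proj₁ p₁-kernel) (sym CP.∘-zeroˡ))

  -- cokernels in Max(C), preserved by T: the hull of the pushout of f along M → 0
  record MaxCokernel {M N : MObj} (f : ∣ M ∣ C.⇒ ∣ N ∣) : Set (o ⊔ ℓ ⊔ o' ⊔ ℓ') where
    field
      obj : MObj
      mor : ∣ N ∣ C.⇒ ∣ obj ∣
      isCokernel : IsCokernel Max MaxP {M} {N} {obj} f mor
      T-isCokernel : IsCokernel A preA (F₁ f) (F₁ mor)

  maxCokernel : ∀ {M N : MObj} (f : ∣ M ∣ C.⇒ ∣ N ∣) → MaxCokernel {M} {N} f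
  maxCokernel {M} {N} f with proj₁ ax2 f (PC.0m {∣ M ∣} {Z})
  ... | Q , i₁ , i₂ , po = record
    { obj = hullObj Q
    ; mor = c
    ; isCokernel = c-cokernel
    ; T-isCokernel = subst (IsCokernel A preA (F₁ f)) (sym homomorphism)
                       (AP.cokernel-∘-iso Ti₁-cokernel unit-iso)
    }
    where
      open Hull (hull ax3 Q)
      i₁-cokernel : IsCokernel C preC f i₁
      i₁-cokernel = CP.pushout-to-zero-is-cokernel Z-zero po
      Ti₁-cokernel : IsCokernel A preA (F₁ f) (F₁ i₁)
      Ti₁-cokernel = AP.pushout-to-zero-is-cokernel (F-zero-object Z-zero)
                       (proj₂ (proj₂ ax2) _ _ i₁ i₂ po)
      c : ∣ N ∣ C.⇒ obj
      c = unit C.∘ i₁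
      c-epi : IsEpi C c
      c-epi = CF.∘-epi (CP.cokernel-epi i₁-cokernel) (inverted-is-epi unit-iso)
      -- a morphism h into a maximal object with h ∘ f = 0 factors as w ∘ i₁,
      -- and w extends along the unit of the hull
      c-cokernel : IsCokernel Max MaxP {M} {N} {hullObj Q} f c
      c-cokernel = trans (CF.pullʳ (proj₁ i₁-cokernel)) CP.∘-zeroʳ , λ {W} h hf≡0 →
        let (w , wi₁≡h , _) = proj₂ i₁-cokernel h hf≡0
            (w' , w'u≡w) = extend ax2 (proj₂ W) unit unit-iso w
            w'c≡h = trans (CF.pullˡ w'u≡w) wi₁≡h
        in w' , w'c≡h , λ v vc≡h → c-epi v w' (trans vc≡h (sym w'c≡h))

  -- T restricted to Max(C) preserves kernels: any kernel is isomorphic to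
  -- the one constructed above, whose image is a kernel
  preserves-kernel : ∀ {K M N : MObj} {f : ∣ M ∣ C.⇒ ∣ N ∣} {k : ∣ K ∣ C.⇒ ∣ M ∣} →
    IsKernel Max MaxP {K} {M} {N} f k → IsKernel A preA (F₁ f) (F₁ k)
  preserves-kernel {K} {M} {N} {f} {k} k-kernel =
    let open MaxKernel (maxKernel {M} {N} f)
        (φ , k≡mor∘φ , φ-iso) = MP.kernel-unique {obj} {K} {M} {N} isKernel k-kernel
    in subst (IsKernel A preA (F₁ f)) (sym (trans (cong F₁ k≡mor∘φ) homomorphism))
         (AP.kernel-∘-iso T-isKernel (F-iso φ-iso))

  -- ... and reflects them: an isomorphism of images of kernels lifts to an
  -- isomorphism in Max(C)
  reflects-kernel : ∀ {K M N : MObj} {f : ∣ M ∣ C.⇒ ∣ N ∣} {k : ∣ K ∣ C.⇒ ∣ M ∣} →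
    IsKernel A preA (F₁ f) (F₁ k) → IsKernel Max MaxP {K} {M} {N} f k
  reflects-kernel {K} {M} {N} {f} {k} Tk-kernel =
    let open MaxKernel (maxKernel {M} {N} f)
        (φ , Fk≡Fmor∘φ , φ-iso) = AP.kernel-unique T-isKernel Tk-kernel
        (φ' , Fφ'≡φ) = lift (proj₂ obj) φ φ-iso
        k≡mor∘φ' = faithful _ _ (trans Fk≡Fmor∘φ
                     (trans (cong (F₁ mor A.∘_) (sym Fφ'≡φ)) (sym homomorphism)))
        φ'-iso = reflects-iso (proj₂ K) (subst (IsIso A) (sym Fφ'≡φ) φ-iso)
    in subst (IsKernel Max MaxP {K} {M} {N} f) (sym k≡mor∘φ')
         (MP.kernel-∘-iso {obj} {K} {M} {N} {φ = φ'} isKernel φ'-iso)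

  preserves-cokernel : ∀ {M N Q : MObj} {f : ∣ M ∣ C.⇒ ∣ N ∣} {c : ∣ N ∣ C.⇒ ∣ Q ∣} →
    IsCokernel Max MaxP {M} {N} {Q} f c → IsCokernel A preA (F₁ f) (F₁ c)
  preserves-cokernel {M} {N} {Q} {f} {c} c-cokernel =
    let open MaxCokernel (maxCokernel {M} {N} f)
        (φ , c≡φ∘mor , φ-iso) = MP.cokernel-unique {obj} {Q} {M} {N} isCokernel c-cokernel
    in subst (IsCokernel A preA (F₁ f)) (sym (trans (cong F₁ c≡φ∘mor) homomorphism))
         (AP.cokernel-∘-iso T-isCokernel (F-iso φ-iso))

  reflects-cokernel : ∀ {M N Q : MObj} {f : ∣ M ∣ C.⇒ ∣ N ∣} {c : ∣ N ∣ C.⇒ ∣ Q ∣} →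
    IsCokernel A preA (F₁ f) (F₁ c) → IsCokernel Max MaxP {M} {N} {Q} f c
  reflects-cokernel {M} {N} {Q} {f} {c} Tc-cokernel =
    let open MaxCokernel (maxCokernel {M} {N} f)
        (φ , Fc≡φ∘Fmor , φ-iso) = AP.cokernel-unique T-isCokernel Tc-cokernel
        (φ' , Fφ'≡φ) = lift (proj₂ Q) φ φ-iso
        c≡φ'∘mor = faithful _ _ (trans Fc≡φ∘Fmor
                     (trans (cong (A._∘ F₁ mor) (sym Fφ'≡φ)) (sym homomorphism)))
        φ'-iso = reflects-iso (proj₂ obj) (subst (IsIso A) (sym Fφ'≡φ) φ-iso)
    in subst (IsCokernel Max MaxP {M} {N} {Q} f) (sym c≡φ'∘mor)
         (MP.cokernel-∘-iso {obj} {Q} {M} {N} {φ = φ'} isCokernel φ'-iso)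

  -- a mono of Max(C) is monic in C: test morphisms out of any object P
  -- extend along the hull of P, which is an epimorphism
  max-mono-is-mono : ∀ {X Y : MObj} {m : ∣ X ∣ C.⇒ ∣ Y ∣} → IsMono Max {X} {Y} m → IsMono C m
  max-mono-is-mono {X} {Y} {m} m-mono {P} a b ma≡mb =
    let open Hull (hull ax3 P)
        (a' , a'u≡a) = extend ax2 (proj₂ X) unit unit-iso a
        (b' , b'u≡b) = extend ax2 (proj₂ X) unit unit-iso b
        a'≡b' = m-mono {hullObj P} a' b' (inverted-is-epi unit-iso _ _
                  (trans (CF.pullʳ a'u≡a) (trans ma≡mb (sym (CF.pullʳ b'u≡b)))))
    in trans (sym a'u≡a) (trans (cong (C._∘ unit) a'≡b') b'u≡b)

  -- dually, morphisms out of the target of an epi of Max(C) which agree on it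
  -- have the same image under T (compose with the hull of their target)
  max-epi-T-cancel : ∀ {X Y : MObj} {e : ∣ X ∣ C.⇒ ∣ Y ∣} → IsEpi Max {X} {Y} e →
    ∀ {P} (a b : ∣ Y ∣ C.⇒ P) → a C.∘ e ≡ b C.∘ e → F₁ a ≡ F₁ b
  max-epi-T-cancel {X} {Y} {e} e-epi {P} a b ae≡be =
    let open Hull (hull ax3 P)
        ua≡ub = e-epi {hullObj P} (unit C.∘ a) (unit C.∘ b)
                  (trans (CF.pullʳ ae≡be) (sym C.assoc))
    in AF.iso-cancelˡ unit-iso (trans (F-resp ua≡ub) homomorphism)

  -- T maps monos of Max(C) to monos: the kernel pair of a mono has equal
  -- projections, and T preserves kernel pairs (Ax2*)
  preserves-mono : ∀ {X Y : MObj} {m : ∣ X ∣ C.⇒ ∣ Y ∣} → IsMono Max {X} {Y} m → IsMono A (F₁ m)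
  preserves-mono {X} {Y} {m} m-mono with proj₁ ax2* m m
  ... | _ , p₁ , p₂ , pb@(mp₁≡mp₂ , _) =
    AF.kernel-pair-mono (proj₂ (proj₂ ax2*) m m p₁ p₂ pb)
      (cong F₁ (max-mono-is-mono {X} {Y} (λ {V} → m-mono {V}) p₁ p₂ mp₁≡mp₂))

  -- T maps epis of Max(C) to epis, via cokernel pairs (Ax2)
  preserves-epi : ∀ {X Y : MObj} {e : ∣ X ∣ C.⇒ ∣ Y ∣} → IsEpi Max {X} {Y} e → IsEpi A (F₁ e)
  preserves-epi {X} {Y} {e} e-epi with proj₁ ax2 e e
  ... | _ , i₁ , i₂ , po@(i₁e≡i₂e , _) =
    AF.cokernel-pair-epi (proj₂ (proj₂ ax2) e e i₁ i₂ po)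
      (max-epi-T-cancel {X} {Y} (λ {V} → e-epi {V}) i₁ i₂ i₁e≡i₂e)

  -- a mono m of Max(C) is a kernel of its cokernel: T m is a mono of the
  -- abelian category A, hence a kernel of T of that cokernel
  mono-is-kernel : ∀ {X Y : MObj} (m : ∣ X ∣ C.⇒ ∣ Y ∣) → IsMono Max {X} {Y} m →
    Σ MObj λ E → Σ (∣ Y ∣ C.⇒ ∣ E ∣) λ c → IsKernel Max MaxP {X} {Y} {E} c m
  mono-is-kernel {X} {Y} m m-mono =
    let (_ , _ , Tm-kernel) = IsAbelian.mono-is-kernel abelianA (F₁ m)
                                (preserves-mono {X} {Y} (λ {V} → m-mono {V}))
        open MaxCokernel (maxCokernel {X} {Y} m)
    in obj , mor , reflects-kernel {X} {Y} {obj} (AP.kernel-of-its-cokernel Tm-kernel T-isCokernel)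

  epi-is-cokernel : ∀ {X Y : MObj} (e : ∣ X ∣ C.⇒ ∣ Y ∣) → IsEpi Max {X} {Y} e →
    Σ MObj λ E → Σ (∣ E ∣ C.⇒ ∣ X ∣) λ k → IsCokernel Max MaxP {E} {X} {Y} k e
  epi-is-cokernel {X} {Y} e e-epi =
    let (_ , _ , Te-cokernel) = IsAbelian.epi-is-cokernel abelianA (F₁ e)
                                  (preserves-epi {X} {Y} (λ {V} → e-epi {V}))
        open MaxKernel (maxKernel {X} {Y} e)
    in obj , mor , reflects-cokernel {obj} {X} {Y} (AP.cokernel-of-its-kernel Te-cokernel T-isKernel)

  maxZero : Σ MObj (IsZeroObject Max MaxP)
  maxZero = hullObj Z , MP.zero-object-from-id {hullObj Z}
    (inverted-is-epi unit-iso C.id PC.0m (CP.out-of-zero-unique Z-zero _ _))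
    where open Hull (hull ax3 Z)

  -- a biproduct of maximal objects is maximal: extending the projections
  -- along the hull S → Ŝ yields a retraction of the hull
  biproduct-is-max : ∀ {M N : MObj} {S} {i₁ : ∣ M ∣ C.⇒ S} {i₂ : ∣ N ∣ C.⇒ S}
    {p₁ : S C.⇒ ∣ M ∣} {p₂ : S C.⇒ ∣ N ∣} → IsBiproduct C preC i₁ i₂ p₁ p₂ → IsMax T S
  biproduct-is-max {M} {N} {S} {i₁} {i₂} {p₁} {p₂} (_ , _ , _ , _ , sum≡id) =
    let open Hull (hull ax3 S)
        (q₁ , q₁u≡p₁) = extend ax2 (proj₂ M) unit unit-iso p₁
        (q₂ , q₂u≡p₂) = extend ax2 (proj₂ N) unit unit-iso p₂
    in retract-is-max obj-max unit-iso (begin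
         (i₁ C.∘ q₁ PC.+ i₂ C.∘ q₂) C.∘ unit
           ≡⟨ PC.∘-distribʳ ⟩
         (i₁ C.∘ q₁) C.∘ unit PC.+ (i₂ C.∘ q₂) C.∘ unit
           ≡⟨ cong₂ PC._+_ (CF.pullʳ q₁u≡p₁) (CF.pullʳ q₂u≡p₂) ⟩
         i₁ C.∘ p₁ PC.+ i₂ C.∘ p₂
           ≡⟨ sum≡id ⟩
         C.id ∎)

  maxBiproduct : ∀ (M N : MObj) → Σ MObj λ S → Σ (∣ M ∣ C.⇒ ∣ S ∣) λ i₁ →
    Σ (∣ N ∣ C.⇒ ∣ S ∣) λ i₂ → Σ (∣ S ∣ C.⇒ ∣ M ∣) λ p₁ →
    Σ (∣ S ∣ C.⇒ ∣ N ∣) λ p₂ → IsBiproduct Max MaxP {M} {N} {S} i₁ i₂ p₁ p₂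
  maxBiproduct M N =
    let (S , i₁ , i₂ , p₁ , p₂ , biproduct) = IsAdditive.biproduct additiveC ∣ M ∣ ∣ N ∣
    in (S , biproduct-is-max {M} {N} biproduct) , i₁ , i₂ , p₁ , p₂ , biproduct

  maxAbelian : IsAbelian Max MaxP
  maxAbelian = record
    { additive = record { zero = maxZero ; biproduct = maxBiproduct }
    ; kernel = λ {M} {N} f → let open MaxKernel (maxKernel {M} {N} f) in obj , mor , isKernel
    ; cokernel = λ {M} {N} f → let open MaxCokernel (maxCokernel {M} {N} f) in obj , mor , isCokernel
    ; mono-is-kernel = λ {X} {Y} → mono-is-kernel {X} {Y}
    ; epi-is-cokernel = λ {X} {Y} → epi-is-cokernel {X} {Y}
    }

  T-exact : IsExact (TMax T) MaxP preA
  T-exact {X} {Y} {W} f g f-kernel g-cokernel =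
    preserves-kernel {X} {Y} {W} f-kernel , preserves-cokernel {X} {Y} {W} g-cokernel

proposition1p5p3 : ∀ {o ℓ o' ℓ'} (C : Category o ℓ) (A : Category o' ℓ') (T : Functor C A)
    → Ax0 T → Ax1 T → Ax2 T → Ax3 T → Ax2* T
    → (preC : Preadditive C) (preA : Preadditive A) → Ax5 T preC preA
    → IsAbelian (MaxCat T) (MaxPre T preC) × IsExact (TMax T) (MaxPre T preC) preA
proposition1p5p3 C A T _ ax1 ax2 ax3 ax2* preC preA ax5 =
  maxAbelian , λ {X} {Y} {W} → T-exact {X} {Y} {W}
  where open Main T ax1 ax2 ax3 ax2* preC preA ax5
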